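{- Let $0 \le a \le n$ be integers and let $G$ be a subgraph of the complete bipartite graph $K_{a,n-a}$. Then $F(G) \leq \binom{n}{a}$.
   Context: For a finite graph $G$, a permutation of the vertices of $G$ is a sequence listing every vertex of $G$ exactly once. Two permutations $\pi,\sigma$ of the vertices of $G$ are called $G$-different if there is an index $i$ such that $\{\pi(i),\sigma(i)\}$ is an edge of $G$. $F(G)$ denotes the maximum size of a family of pairwise $G$-different permutations of the vertices of $G$. -}

module Defs where

open import Data.Nat using (ℕ)
open import Data.Fin using (Fin)
open import Data.Fin.Subset using (Subset; _∈_; _∉_; ∣_∣)
open import Relation.Binary.PropositionalEquality using (_≡_)
open import Data.Fin.Permutation using (Permutation′; _⟨$⟩ʳ_)
open import Data.List using (List)
open import Data.List.Relation.Unary.AllPairs using (AllPairs)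
open import Data.Product using (Σ; _×_; ∃)
open import Data.Sum using (_⊎_)
open import Relation.Nullary using (¬_)

record Graph (n : ℕ) : Set₁ where
  field
    Adj   : Fin n → Fin n → Set
    sym   : ∀ {u v} → Adj u v → Adj v u
    irrefl : ∀ {u} → ¬ Adj u u
open Graph public

-- G is a subgraph of the complete bipartite graph K_{a,n-a} on the same
-- vertex set: there is a part S with |S| = a (the other part has n - a
-- vertices) such that every edge joins S to its complement.
IsSubgraphOfKBip : ∀ {n} → ℕ → Graph n → Set
IsSubgraphOfKBip {n} a G =
  Σ (Subset n) λ S → (∣ S ∣ ≡ a) ×
    (∀ u v → Adj G u v → (u ∈ S × v ∉ S) ⊎ (u ∉ S × v ∈ S))

-- A permutation of the vertices, viewed as a sequence: position i holds π ⟨$⟩ʳ i.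
-- Two permutations are G-different if some position holds adjacent vertices.
GDifferent : ∀ {n} → Graph n → Permutation′ n → Permutation′ n → Set
GDifferent {n} G π σ = ∃ λ (i : Fin n) → Adj G (π ⟨$⟩ʳ i) (σ ⟨$⟩ʳ i)

-- A family (pairwise G-difference forces distinct entries, G being irreflexive) of pairwise G-different permutations.
PairwiseGDifferent : ∀ {n} → Graph n → List (Permutation′ n) → Set
PairwiseGDifferent G = AllPairs (GDifferent G)

module Submission where

-- Fix the part S of size a. A permutation π, read as a sequence, determines
-- the set π⁻¹(S) of positions holding a vertex of S; it has a elements. If π
-- and σ are G-different at position i, then π(i) and σ(i) are adjacent, so
-- exactly one of them lies in S and the two position sets differ at i. Hence
-- the family injects into the a-subsets of an n-set, of which there are n C a.

open import Defs
open import Data.Nat using (ℕ; _≤_)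
open import Data.Nat.Combinatorics using (_C_)
open import Data.List using (List; length)
open import Data.Fin.Permutation using (Permutation′)

open import Data.Nat using (zero; suc; _+_; z≤n; s≤s)
open import Data.Nat.Properties
  using (suc-injective; +-suc; +-mono-≤; +-0-commutativeMonoid)
open import Data.Nat.Combinatorics using (nCk+nC[k+1]≡[n+1]C[k+1])
open import Data.Fin.Subset using (Subset; Side; inside; outside; ∣_∣; _∈_; _∉_)
open import Data.Fin.Permutation using (_⟨$⟩ʳ_)
open import Data.Vec using ([]; _∷_; lookup; tabulate)
open import Data.Vec.Properties using (lookup∘tabulate; []=⇒lookup; lookup⇒[]=)
open import Data.List using ([]; _∷_; map)
open import Data.List.Properties using (length-map)
open import Data.List.Relation.Unary.All as All using (All; []; _∷_)
import Data.List.Relation.Unary.All.Properties as All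
open import Data.List.Relation.Unary.AllPairs as AllPairs using (AllPairs; []; _∷_)
import Data.List.Relation.Unary.AllPairs.Properties as AllPairs
open import Data.List.Relation.Unary.Unique.Propositional using (Unique)
import Data.List.Relation.Unary.Unique.Propositional.Properties as Unique
open import Data.List.Relation.Binary.Sublist.Propositional
  using (_⊆_; _⊇_; []; _∷_; _∷ʳ_)
open import Data.List.Relation.Binary.Sublist.Propositional.Properties using (All-resp-⊆)
open import Data.Product using (_,_; _×_)
open import Data.Sum using (_⊎_; inj₁; inj₂)
open import Data.Empty using (⊥-elim)
open import Function using (_∘_)
open import Relation.Binary.Core using (Rel)
open import Relation.Binary.Definitions using (_Respects_)
open import Relation.Binary.PropositionalEquality
  using (_≡_; _≢_; refl; trans; cong; subst; module ≡-Reasoning)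
import Relation.Binary.PropositionalEquality as ≡
import Algebra.Properties.CommutativeMonoid.Sum as MonoidSum

open MonoidSum +-0-commutativeMonoid using (sum; sum-cong-≗; sum-permute)

AllPairs-resp-⊆ : ∀ {a ℓ} {A : Set a} {R : Rel A ℓ} → (AllPairs R) Respects _⊇_
AllPairs-resp-⊆ []         []       = []
AllPairs-resp-⊆ (_ ∷ʳ τ)   (_ ∷ rs) = AllPairs-resp-⊆ τ rs
AllPairs-resp-⊆ (refl ∷ τ) (r ∷ rs) = All-resp-⊆ τ r ∷ AllPairs-resp-⊆ τ rs

withHead : ∀ {m} → Side → List (Subset (suc m)) → List (Subset m)
withHead s [] = []
withHead inside  ((inside  ∷ p) ∷ L) = p ∷ withHead inside L
withHead inside  ((outside ∷ p) ∷ L) = withHead inside L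
withHead outside ((inside  ∷ p) ∷ L) = withHead outside L
withHead outside ((outside ∷ p) ∷ L) = p ∷ withHead outside L

withHead-⊆ : ∀ {m} s (L : List (Subset (suc m))) → map (s ∷_) (withHead s L) ⊆ L
withHead-⊆ s       []                  = []
withHead-⊆ inside  ((inside  ∷ p) ∷ L) = refl ∷ withHead-⊆ inside L
withHead-⊆ inside  ((outside ∷ p) ∷ L) = _ ∷ʳ withHead-⊆ inside L
withHead-⊆ outside ((inside  ∷ p) ∷ L) = _ ∷ʳ withHead-⊆ outside L
withHead-⊆ outside ((outside ∷ p) ∷ L) = refl ∷ withHead-⊆ outside L

length-withHead : ∀ {m} (L : List (Subset (suc m))) →
  length L ≡ length (withHead inside L) + length (withHead outside L)
length-withHead [] = refl
length-withHead ((inside ∷ p) ∷ L) = cong suc (length-withHead L)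
length-withHead ((outside ∷ p) ∷ L) = trans (cong suc (length-withHead L))
  (≡.sym (+-suc (length (withHead inside L)) (length (withHead outside L))))

module _ {m} (s : Side) {L : List (Subset (suc m))} where

  All-withHead : ∀ {ℓ} {P : Subset (suc m) → Set ℓ} →
    All P L → All (λ p → P (s ∷ p)) (withHead s L)
  All-withHead ps = All.map⁻ (All-resp-⊆ (withHead-⊆ s L) ps)

  Unique-withHead : Unique L → Unique (withHead s L)
  Unique-withHead u = Unique.map⁻ (AllPairs-resp-⊆ (withHead-⊆ s L) u)

-- Pascal's rule, splitting the subsets by membership of the first element.
length≤C : ∀ n k (L : List (Subset n)) →
  All (λ p → ∣ p ∣ ≡ k) L → Unique L → length L ≤ n C k
length≤C zero k [] _ _ = z≤n
length≤C zero .0 ([] ∷ []) (refl ∷ []) _ = s≤s z≤n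
length≤C zero k ([] ∷ [] ∷ L) _ ((≢[] ∷ _) ∷ _) = ⊥-elim (≢[] refl)
length≤C (suc m) k L sizes u = subst (_≤ suc m C k) (≡.sym (length-withHead L)) (split k sizes)
  where
  ins = withHead inside L
  outs = withHead outside L

  outs≤ : ∀ {k} → All (λ p → ∣ p ∣ ≡ k) L → length outs ≤ m C k
  outs≤ {k} sizes =
    length≤C m k outs (All-withHead outside sizes) (Unique-withHead outside u)

  split : ∀ k → All (λ p → ∣ p ∣ ≡ k) L → length ins + length outs ≤ suc m C k
  split zero sizes with ins | All-withHead inside sizes
  ... | [] | [] = outs≤ sizes
  ... | _ ∷ _ | () ∷ _
  split (suc k) sizes = subst (length ins + length outs ≤_) (nCk+nC[k+1]≡[n+1]C[k+1] m k)
    (+-mono-≤ (length≤C m k ins (All.map suc-injective (All-withHead inside sizes))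
                                (Unique-withHead inside u))
              (outs≤ sizes))

indicator : Side → ℕ
indicator inside  = 1
indicator outside = 0

∣p∣≡sum : ∀ {n} (p : Subset n) → ∣ p ∣ ≡ sum (λ i → indicator (lookup p i))
∣p∣≡sum [] = refl
∣p∣≡sum (inside  ∷ p) = cong suc (∣p∣≡sum p)
∣p∣≡sum (outside ∷ p) = ∣p∣≡sum p

preimage : ∀ {n} → Permutation′ n → Subset n → Subset n
preimage π S = tabulate (λ i → lookup S (π ⟨$⟩ʳ i))

lookup-preimage : ∀ {n} (π : Permutation′ n) (S : Subset n) i →
  lookup (preimage π S) i ≡ lookup S (π ⟨$⟩ʳ i)
lookup-preimage π S = lookup∘tabulate (λ i → lookup S (π ⟨$⟩ʳ i))

∣preimage∣ : ∀ {n} (π : Permutation′ n) (S : Subset n) → ∣ preimage π S ∣ ≡ ∣ S ∣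
∣preimage∣ π S = begin
  ∣ preimage π S ∣                                 ≡⟨ ∣p∣≡sum (preimage π S) ⟩
  sum (λ i → indicator (lookup (preimage π S) i))  ≡⟨ sum-cong-≗ (cong indicator ∘ lookup-preimage π S) ⟩
  sum (λ i → indicator (lookup S (π ⟨$⟩ʳ i)))      ≡⟨ sum-permute (indicator ∘ lookup S) π ⟨
  sum (λ i → indicator (lookup S i))               ≡⟨ ∣p∣≡sum S ⟨
  ∣ S ∣                                            ∎
  where open ≡-Reasoning

separated⇒lookup≢ : ∀ {n} {S : Subset n} {u v} →
  (u ∈ S × v ∉ S) ⊎ (u ∉ S × v ∈ S) → lookup S u ≢ lookup S v
separated⇒lookup≢ {S = S} {u} {v} (inj₁ (u∈S , v∉S)) eq =
  v∉S (lookup⇒[]= v S (trans (≡.sym eq) ([]=⇒lookup u∈S)))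
separated⇒lookup≢ {S = S} {u} {v} (inj₂ (u∉S , v∈S)) eq =
  u∉S (lookup⇒[]= u S (trans eq ([]=⇒lookup v∈S)))

GDifferent⇒preimage≢ : ∀ {n a} (G : Graph n) ((S , _) : IsSubgraphOfKBip a G) →
  ∀ {π σ} → GDifferent G π σ → preimage π S ≢ preimage σ S
GDifferent⇒preimage≢ G (S , _ , crossing) {π} {σ} (i , adj) eq =
  separated⇒lookup≢ (crossing _ _ adj) (begin
    lookup S (π ⟨$⟩ʳ i)       ≡⟨ lookup-preimage π S i ⟨
    lookup (preimage π S) i   ≡⟨ cong (λ p → lookup p i) eq ⟩
    lookup (preimage σ S) i   ≡⟨ lookup-preimage σ S i ⟩
    lookup S (σ ⟨$⟩ʳ i)       ∎)
  where open ≡-Reasoning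

corollary1 : (n a : ℕ) → a ≤ n → (G : Graph n) → IsSubgraphOfKBip a G →
    (𝓕 : List (Permutation′ n)) → PairwiseGDifferent G 𝓕 → length 𝓕 ≤ n C a
corollary1 n a _ G B@(S , ∣S∣≡a , _) 𝓕 pairwise =
  subst (_≤ n C a) (length-map preimage′ 𝓕)
    (length≤C n a (map preimage′ 𝓕) sizes distinct)
  where
  preimage′ : Permutation′ n → Subset n
  preimage′ π = preimage π S

  sizes : All (λ p → ∣ p ∣ ≡ a) (map preimage′ 𝓕)
  sizes = All.map⁺ (All.universal (λ π → trans (∣preimage∣ π S) ∣S∣≡a) 𝓕)

  distinct : Unique (map preimage′ 𝓕)
  distinct = AllPairs.map⁺ {f = preimage′}
    (AllPairs.map (λ {π} {σ} → GDifferent⇒preimage≢ G B {π} {σ}) pairwise)
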